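{- Let $a,r,s\in\mathbb N$. There exist polynomials $\mathcal P_{a,r,n}(x)$ and $\mathcal P_{a,r,s,n}(x)$ ($n\in\mathbb N_0$) such that for all $k\in\mathbb Z$ $$\mathcal A_{a,k,r}(q)=\sum_{n\ge0}\mathcal P_{a,r,n}(k)\,q^n,\qquad \mathcal B_{a,k,r,s}(q)=\sum_{n\ge0}\mathcal P_{a,r,s,n}(k)\,q^n,$$ where $\mathcal P_{a,r,n}$ has degree exactly $n-\frac12 ra(a+1)$ for $n\ge \frac12 ra(a+1)$, and $\mathcal P_{a,r,s,n}$ has degree exactly $n-\frac16 a(a+1)(r+2ar+3s)$ for $n\ge\frac16 a(a+1)(r+2ar+3s)$ (and these polynomials are $0$ for smaller $n$).
   Context: For $a,r,s\in\mathbb N$ and $k\in\mathbb Z$ define $$\mathcal A_{a,k,r}(q):=\sum_{1\le n_1<\dots<n_a}\frac{q^{r(n_1+\dots+n_a)}}{(1-q^{n_1})^k\cdots(1-q^{n_a})^k},\qquad \mathcal B_{a,k,r,s}(q):=\sum_{1\le n_1<\dots<n_a}\frac{q^{r(n_1^2+\dots+n_a^2)+s(n_1+\dots+n_a)}}{(1-q^{n_1})^k\cdots(1-q^{n_a})^k},$$ viewed as formal power series in $q$. -}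

module Defs where

open import Data.Nat as ℕ using (ℕ; zero; suc; _∸_; _≤ᵇ_; _≡ᵇ_)
open import Data.Integer as ℤ using (ℤ; +_; -[1+_])
open import Data.Rational as ℚ using (ℚ; 0ℚ)
open import Data.List using (List; []; _∷_; map; foldr; concatMap; applyUpTo; length; upTo; last)
open import Data.List.Relation.Unary.All using (All)
open import Data.Maybe using (just)
open import Data.Bool using (if_then_else_)
open import Data.Product using (_×_)
open import Relation.Binary.PropositionalEquality using (_≡_; _≢_)
open import Relation.Nullary.Decidable using (does)
open import Data.Nat.Divisibility using (_∣?_)

Series : Set
Series = ℕ → ℤ

sumℤ : List ℤ → ℤ
sumℤ = foldr ℤ._+_ (+ 0)

sumℕ : List ℕ → ℕ
sumℕ = foldr ℕ._+_ 0

oneS : Series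
oneS zero    = + 1
oneS (suc _) = + 0

mulS : Series → Series → Series
mulS f g N = sumℤ (map (λ i → f i ℤ.* g (N ∸ i)) (upTo (suc N)))

powS : Series → ℕ → Series
powS f zero    = oneS
powS f (suc m) = mulS f (powS f m)

oneMinusQ : ℕ → Series
oneMinusQ n m = (if m ≡ᵇ 0 then + 1 else + 0) ℤ.- (if m ≡ᵇ n then + 1 else + 0)

-- 1/(1 - q^n) = Σ_{j ≥ 0} q^{nj}   (n ≥ 1)
geomQ : ℕ → Series
geomQ n m = if does (n ∣? m) then + 1 else + 0

invPowOneMinusQ : ℕ → ℤ → Series
invPowOneMinusQ n (+ m)     = powS (geomQ n) m
invPowOneMinusQ n -[1+ m ]  = powS (oneMinusQ n) (suc m)

prodInv : ℤ → List ℕ → Series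
prodInv k t = foldr (λ n acc → mulS (invPowOneMinusQ n k) acc) oneS t

shiftCoeff : ℕ → Series → ℕ → ℤ
shiftCoeff e f N = if e ≤ᵇ N then f (N ∸ e) else + 0

incTuples : ℕ → ℕ → ℕ → List (List ℕ)
incTuples zero    lo M = [] ∷ []
incTuples (suc a) lo M =
  concatMap (λ x → map (x ∷_) (incTuples a (suc x) M)) (applyUpTo (lo ℕ.+_) (suc M ∸ lo))

-- Coefficient of q^N in A_{a,k,r}(q).  Only tuples 1 ≤ n₁ < … < n_a ≤ N can
-- contribute to q^N (since r ≥ 1, the summand starts at q^{r(n₁+…+n_a)}).
coeffA : ℕ → ℤ → ℕ → ℕ → ℤ
coeffA a k r N = sumℤ (map (λ t → shiftCoeff (r ℕ.* sumℕ t) (prodInv k t) N) (incTuples a 1 N))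

coeffB : ℕ → ℤ → ℕ → ℕ → ℕ → ℤ
coeffB a k r s N =
  sumℤ (map (λ t → shiftCoeff (r ℕ.* sumℕ (map (λ n → n ℕ.* n) t) ℕ.+ s ℕ.* sumℕ t) (prodInv k t) N)
            (incTuples a 1 N))

-- Polynomials over ℚ as coefficient lists (constant term first).

Poly : Set
Poly = List ℚ

evalPoly : Poly → ℚ → ℚ
evalPoly p x = foldr (λ c acc → c ℚ.+ x ℚ.* acc) 0ℚ p

ℤtoℚ : ℤ → ℚ
ℤtoℚ k = k ℚ./ 1

HasDegree : Poly → ℕ → Set
HasDegree p d = (length p ≡ suc d) × (∀ c → last p ≡ just c → c ≢ 0ℚ)

IsZeroPoly : Poly → Set
IsZeroPoly p = All (_≡ 0ℚ) p

{-# OPTIONS --safe #-}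
-- For n ≥ 1 the coefficient of q^(jn) in (1 - q^n)^(-k) is the multichoose polynomial
-- k(k+1)⋯(k+j-1)/j!, by Pascal's rule and induction on k ∈ ℤ.  Hence the coefficient of q^N
-- in ∏_{n ∈ t} (1 - q^n)^(-k) is a polynomial in k of degree at most N whose coefficient of k^N
-- is nonnegative, and positive when 1 ∈ t.  The tuple t contributes these polynomials shifted
-- by its weight σ t, and among increasing tuples of length a the weight is least, equal to the
-- threshold Th, at t = (1, …, a).  So the coefficient of q^N is a polynomial of degree at most
-- N - Th whose coefficient of k^(N - Th) is a sum of nonnegative terms, the one of (1, …, a)
-- being positive.
module Submission where

open import Defs
open import Data.Nat using (ℕ; _≤_; _<_; _∸_; _*_; _+_; _/_)
open import Data.Integer using (ℤ)
open import Data.Product using (Σ; _×_)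
open import Relation.Binary.PropositionalEquality using (_≡_)

open import Algebra.Bundles using (CommutativeMonoid)
open import Data.Bool using (true; false; if_then_else_; T)
open import Data.Integer as ℤ using (+_; -[1+_])
import Data.Integer.Properties as ℤ
open import Data.List using (List; []; _∷_; _++_; map; foldr; applyUpTo; upTo; take; length; last)
import Data.List.Properties as List
open import Data.List.Membership.Propositional using (_∈_)
open import Data.List.Relation.Unary.All using (All; []; _∷_)
import Data.List.Relation.Unary.All as All using (map)
import Data.List.Relation.Unary.All.Properties as All
open import Data.List.Relation.Unary.Any using (Any; here; there)
import Data.List.Relation.Unary.Any as Any using (map)
import Data.List.Relation.Unary.Any.Properties as Any
open import Data.Maybe using (just)
open import Data.Maybe.Properties using (just-injective)
open import Data.Nat as ℕ using (zero; suc; z≤n; s≤s; _≤ᵇ_; _≡ᵇ_)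
open import Data.Nat.Coprimality using (1-coprimeTo) renaming (sym to coprime-sym)
open import Data.Nat.Divisibility using (_∣_; _∣?_; _∣0; 1∣_; ∣-refl; ∣⇒≤; ∣m+n∣m⇒∣n; ∣m∸n∣n⇒∣m)
open import Data.Nat.DivMod using (m≥n⇒m/n>0; [m∸n]/n≡m/n∸1; m/n≤m; n/1≡n; m*n/n≡m)
open import Data.Nat.Induction using (<-rec)
open import Data.Nat.ListAction.Properties using (sum-++)
import Data.Nat.Properties as ℕ
import Data.Nat.Tactic.RingSolver as ℕ-RingSolver
open import Data.Product using (_,_; proj₁; proj₂)
open import Data.Rational as ℚ using (ℚ; 0ℚ; 1ℚ; _-_; -_; 1/_)
  renaming (_+_ to _+ℚ_; _*_ to _*ℚ_; _≤_ to _≤ℚ_; _<_ to _<ℚ_)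
open import Data.Rational.Literals using (fromℤ)
import Data.Rational.Properties as ℚ
open import Algebra.Properties.CommutativeSemigroup
  (CommutativeMonoid.commutativeSemigroup ℚ.+-0-commutativeMonoid)
  using () renaming (interchange to +-interchange)
open import Data.Sum using (inj₁; inj₂)
open import Data.Unit using (tt)
open import Function using (_∘_; id)
open import Function.Bundles using (_⇔_; mk⇔; Equivalence)
open import Level using (0ℓ)
open import Relation.Binary.Core using (_Preserves_⟶_)
open import Relation.Binary.Definitions using (tri<; tri≈; tri>)
open import Relation.Binary.PropositionalEquality
  using (_≢_; refl; sym; trans; cong; cong₂; subst; subst₂; module ≡-Reasoning)
open import Relation.Nullary using (yes; no; does; contradiction)
open import Relation.Nullary.Decidable using (dec-true; dec-false; does-⇔)
open import Relation.Nullary.Decidable.Core using (dec⇒maybe)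
open import Tactic.RingSolver using (solve-∀)
open import Tactic.RingSolver.Core.AlmostCommutativeRing using (AlmostCommutativeRing; fromCommutativeRing)

-- Integers in ℚ and finite sums

ℚ-ring : AlmostCommutativeRing 0ℓ 0ℓ
ℚ-ring = fromCommutativeRing ℚ.+-*-commutativeRing (λ x → dec⇒maybe (0ℚ ℚ.≟ x))

ℤtoℚ≡fromℤ : ∀ k → ℤtoℚ k ≡ fromℤ k
ℤtoℚ≡fromℤ (+ n)    = ℚ.normalize-coprime {n} {0} (coprime-sym (1-coprimeTo n))
ℤtoℚ≡fromℤ -[1+ n ] = cong -_ (ℚ.normalize-coprime {suc n} {0} (coprime-sym (1-coprimeTo (suc n))))

fromℤ-+ : ∀ i j → fromℤ (i ℤ.+ j) ≡ fromℤ i +ℚ fromℤ j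
fromℤ-+ i j = sym (trans (cong (ℚ._/ 1) (cong₂ ℤ._+_ (ℤ.*-identityʳ i) (ℤ.*-identityʳ j)))
                         (ℤtoℚ≡fromℤ (i ℤ.+ j)))

fromℤ-* : ∀ i j → fromℤ (i ℤ.* j) ≡ fromℤ i *ℚ fromℤ j
fromℤ-* i j = sym (ℤtoℚ≡fromℤ (i ℤ.* j))

fromℤ-neg : ∀ i → fromℤ (ℤ.- i) ≡ - fromℤ i
fromℤ-neg (+ zero)  = refl
fromℤ-neg (+ suc n) = refl
fromℤ-neg -[1+ n ]  = refl

fromℤ-- : ∀ i j → fromℤ (i ℤ.- j) ≡ fromℤ i - fromℤ j
fromℤ-- i j = trans (fromℤ-+ i (ℤ.- j)) (cong (fromℤ i +ℚ_) (fromℤ-neg j))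

fromℤ-suc : ∀ k → fromℤ (+ 1 ℤ.+ k) ≡ 1ℚ +ℚ fromℤ k
fromℤ-suc = fromℤ-+ (+ 1)

sumℚ : List ℚ → ℚ
sumℚ = foldr _+ℚ_ 0ℚ

fromℤ-sumℤ : ∀ xs → fromℤ (sumℤ xs) ≡ sumℚ (map fromℤ xs)
fromℤ-sumℤ []       = refl
fromℤ-sumℤ (x ∷ xs) = trans (fromℤ-+ x (sumℤ xs)) (cong (fromℤ x +ℚ_) (fromℤ-sumℤ xs))

sumℚ-zero : ∀ {xs} → All (_≡ 0ℚ) xs → sumℚ xs ≡ 0ℚ
sumℚ-zero []           = refl
sumℚ-zero (x≡0 ∷ xs≡0) = trans (cong₂ _+ℚ_ x≡0 (sumℚ-zero xs≡0)) (ℚ.+-identityˡ 0ℚ)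

sumℚ-nonneg : ∀ {xs} → All (0ℚ ≤ℚ_) xs → 0ℚ ≤ℚ sumℚ xs
sumℚ-nonneg []           = ℚ.≤-refl
sumℚ-nonneg (x≥0 ∷ xs≥0) = ℚ.+-mono-≤ x≥0 (sumℚ-nonneg xs≥0)

sumℚ-pos : ∀ {xs} → All (0ℚ ≤ℚ_) xs → Any (0ℚ <ℚ_) xs → 0ℚ <ℚ sumℚ xs
sumℚ-pos (_ ∷ xs≥0)   (here x>0)   = ℚ.+-mono-<-≤ x>0 (sumℚ-nonneg xs≥0)
sumℚ-pos (x≥0 ∷ xs≥0) (there xs>0) = ℚ.+-mono-≤-< x≥0 (sumℚ-pos xs≥0 xs>0)

*-nonneg : ∀ {p q} → 0ℚ ≤ℚ p → 0ℚ ≤ℚ q → 0ℚ ≤ℚ p *ℚ q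
*-nonneg {p} {q} p≥0 q≥0 =
  ℚ.nonNegative⁻¹ _ {{ℚ.nonNeg*nonNeg⇒nonNeg p {{ℚ.nonNegative p≥0}} q {{ℚ.nonNegative q≥0}}}}

*-pos : ∀ {p q} → 0ℚ <ℚ p → 0ℚ <ℚ q → 0ℚ <ℚ p *ℚ q
*-pos {p} {q} p>0 q>0 = ℚ.positive⁻¹ _ {{ℚ.pos*pos⇒pos p {{ℚ.positive p>0}} q {{ℚ.positive q>0}}}}

∑< : ℕ → (ℕ → ℚ) → ℚ
∑< n f = sumℚ (applyUpTo f n)

syntax ∑< n (λ i → e) = ∑[ i < n ] e

∑-cong : ∀ n {f g : ℕ → ℚ} → (∀ i → i < n → f i ≡ g i) → ∑< n f ≡ ∑< n g
∑-cong zero    f≡g = refl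
∑-cong (suc n) f≡g = cong₂ _+ℚ_ (f≡g 0 (s≤s z≤n)) (∑-cong n (λ i i<n → f≡g (suc i) (s≤s i<n)))

∑-zero : ∀ n {f : ℕ → ℚ} → (∀ i → i < n → f i ≡ 0ℚ) → ∑< n f ≡ 0ℚ
∑-zero n f≡0 = trans (∑-cong n f≡0) (sumℚ-zero (All.applyUpTo⁺₂ (λ _ → 0ℚ) n (λ _ → refl)))

∑-+ : ∀ n (f g : ℕ → ℚ) → ∑[ i < n ] (f i +ℚ g i) ≡ ∑< n f +ℚ ∑< n g
∑-+ zero    f g = refl
∑-+ (suc n) f g = trans (cong ((f 0 +ℚ g 0) +ℚ_) (∑-+ n (f ∘ suc) (g ∘ suc)))
                        (+-interchange (f 0) (g 0) (∑< n (f ∘ suc)) (∑< n (g ∘ suc)))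

∑-neg : ∀ n (f : ℕ → ℚ) → ∑[ i < n ] (- f i) ≡ - ∑< n f
∑-neg zero    f = refl
∑-neg (suc n) f = trans (cong (- f 0 +ℚ_) (∑-neg n (f ∘ suc)))
                        (sym (ℚ.neg-distrib-+ (f 0) (∑< n (f ∘ suc))))

∑-− : ∀ n (f g : ℕ → ℚ) → ∑[ i < n ] (f i - g i) ≡ ∑< n f - ∑< n g
∑-− n f g = trans (∑-+ n f (-_ ∘ g)) (cong (∑< n f +ℚ_) (∑-neg n g))

∑-split : ∀ m n (f : ℕ → ℚ) → ∑< (m + n) f ≡ ∑< m f +ℚ ∑[ j < n ] f (m + j)
∑-split zero    n f = sym (ℚ.+-identityˡ _)
∑-split (suc m) n f = trans (cong (f 0 +ℚ_) (∑-split m n (f ∘ suc))) (sym (ℚ.+-assoc (f 0) _ _))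

∑-single : ∀ n c (f : ℕ → ℚ) → c < n → (∀ i → i < n → i ≢ c → f i ≡ 0ℚ) → ∑< n f ≡ f c
∑-single (suc n) zero    f _         others =
  trans (cong (f 0 +ℚ_) (∑-zero n (λ i i<n → others (suc i) (s≤s i<n) λ ()))) (ℚ.+-identityʳ (f 0))
∑-single (suc n) (suc c) f (s≤s c<n) others =
  trans (cong₂ _+ℚ_ (others 0 (s≤s z≤n) λ ())
                    (∑-single n c (f ∘ suc) c<n (λ i i<n i≢c → others (suc i) (s≤s i<n) (i≢c ∘ ℕ.suc-injective))))
        (ℚ.+-identityˡ (f (suc c)))

∑-nonneg : ∀ n {f : ℕ → ℚ} → (∀ i → i < n → 0ℚ ≤ℚ f i) → 0ℚ ≤ℚ ∑< n f
∑-nonneg n {f} f≥0 = sumℚ-nonneg (All.applyUpTo⁺₁ f n (λ {i} → f≥0 i))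

∑-pos : ∀ n {f : ℕ → ℚ} c → (∀ i → i < n → 0ℚ ≤ℚ f i) → c < n → 0ℚ <ℚ f c → 0ℚ <ℚ ∑< n f
∑-pos n {f} c f≥0 c<n fc>0 = sumℚ-pos (All.applyUpTo⁺₁ f n (λ {i} → f≥0 i)) (Any.applyUpTo⁺ f fc>0 c<n)

-- Shifts and convolution of coefficient sequences

shift : {A : Set} → A → ℕ → (ℕ → A) → ℕ → A
shift z e f N = if e ≤ᵇ N then f (N ∸ e) else z

module _ {A : Set} (z : A) (f : ℕ → A) where

  shift-≥ : ∀ {e N} → e ≤ N → shift z e f N ≡ f (N ∸ e)
  shift-≥ {e} {N} e≤N with e ≤ᵇ N | ℕ.≤⇒≤ᵇ e≤N
  ... | true | _ = refl

  shift-< : ∀ {e N} → N < e → shift z e f N ≡ z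
  shift-< {e} {N} N<e with e ≤ᵇ N in eq
  ... | false = refl
  ... | true  = contradiction (ℕ.≤ᵇ⇒≤ e N (subst T (sym eq) tt)) (ℕ.<⇒≱ N<e)

  shift-map : ∀ {B : Set} (h : A → B) e N → h (shift z e f N) ≡ shift (h z) e (h ∘ f) N
  shift-map h e N with e ≤ᵇ N
  ... | true  = refl
  ... | false = refl

shift-cong : ∀ {A : Set} (z : A) {f g : ℕ → A} e N → (∀ M → f M ≡ g M) → shift z e f N ≡ shift z e g N
shift-cong z e N f≡g with e ≤ᵇ N
... | true  = f≡g (N ∸ e)
... | false = refl

shift-cong-< : ∀ {A : Set} (z : A) {f g : ℕ → A} {e N} → 0 < e → (∀ M → M < N → f M ≡ g M) →
               shift z e f N ≡ shift z e g N
shift-cong-< z {f} {g} {e} {N} e>0 f≡g with e ℕ.≤? N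
... | yes e≤N = trans (shift-≥ z f e≤N) (trans (f≡g (N ∸ e) (ℕ.∸-monoʳ-< e>0 e≤N)) (sym (shift-≥ z g e≤N)))
... | no  e≰N = trans (shift-< z f (ℕ.≰⇒> e≰N)) (sym (shift-< z g (ℕ.≰⇒> e≰N)))

shift-fixpoint-unique : ∀ {e} {h A B : ℕ → ℚ} → 0 < e →
  (∀ N → A N ≡ h N +ℚ shift 0ℚ e A N) → (∀ N → B N ≡ h N +ℚ shift 0ℚ e B N) → ∀ N → A N ≡ B N
shift-fixpoint-unique {e} {h} {A} {B} e>0 A-fix B-fix = <-rec (λ N → A N ≡ B N) step
  where
  step : ∀ N → (∀ {M} → M < N → A M ≡ B M) → A N ≡ B N
  step N A≡B-below =
    trans (A-fix N) (trans (cong (h N +ℚ_) (shift-cong-< 0ℚ e>0 (λ M → A≡B-below))) (sym (B-fix N)))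

infixl 7 _⋆_

_⋆_ : (ℕ → ℚ) → (ℕ → ℚ) → ℕ → ℚ
(f ⋆ g) N = ∑[ i < suc N ] (f i *ℚ g (N ∸ i))

oneℚ : ℕ → ℚ
oneℚ N = fromℤ (oneS N)

oneℚ-≢0 : ∀ {N} → N ≢ 0 → oneℚ N ≡ 0ℚ
oneℚ-≢0 {zero}  N≢0 = contradiction refl N≢0
oneℚ-≢0 {suc N} _   = refl

fromℤ-mulS : ∀ f g N → fromℤ (mulS f g N) ≡ ((fromℤ ∘ f) ⋆ (fromℤ ∘ g)) N
fromℤ-mulS f g N = begin
  fromℤ (sumℤ (map term (upTo (suc N))))     ≡⟨ cong (fromℤ ∘ sumℤ) (List.map-upTo term (suc N)) ⟩
  fromℤ (sumℤ (applyUpTo term (suc N)))      ≡⟨ fromℤ-sumℤ (applyUpTo term (suc N)) ⟩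
  sumℚ (map fromℤ (applyUpTo term (suc N)))  ≡⟨ cong sumℚ (List.map-applyUpTo term fromℤ (suc N)) ⟩
  ∑< (suc N) (fromℤ ∘ term)                  ≡⟨ ∑-cong (suc N) (λ i _ → fromℤ-* (f i) (g (N ∸ i))) ⟩
  ((fromℤ ∘ f) ⋆ (fromℤ ∘ g)) N              ∎
  where
  open ≡-Reasoning
  term : ℕ → ℤ
  term i = f i ℤ.* g (N ∸ i)

⋆-cong : ∀ {f f′ g g′ : ℕ → ℚ} → (∀ i → f i ≡ f′ i) → (∀ i → g i ≡ g′ i) → ∀ N → (f ⋆ g) N ≡ (f′ ⋆ g′) N
⋆-cong f≡f′ g≡g′ N = ∑-cong (suc N) (λ i _ → cong₂ _*ℚ_ (f≡f′ i) (g≡g′ (N ∸ i)))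

⋆-distribʳ-+ : ∀ (f g h : ℕ → ℚ) N → ((λ i → f i +ℚ g i) ⋆ h) N ≡ (f ⋆ h) N +ℚ (g ⋆ h) N
⋆-distribʳ-+ f g h N = trans (∑-cong (suc N) (λ i _ → ℚ.*-distribʳ-+ (h (N ∸ i)) (f i) (g i)))
                             (∑-+ (suc N) (λ i → f i *ℚ h (N ∸ i)) (λ i → g i *ℚ h (N ∸ i)))

⋆-distribʳ-− : ∀ (f g h : ℕ → ℚ) N → ((λ i → f i - g i) ⋆ h) N ≡ (f ⋆ h) N - (g ⋆ h) N
⋆-distribʳ-− f g h N = trans (∑-cong (suc N) (λ i _ → *-distribʳ-− (h (N ∸ i)) (f i) (g i)))
                             (∑-− (suc N) (λ i → f i *ℚ h (N ∸ i)) (λ i → g i *ℚ h (N ∸ i)))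
  where
  *-distribʳ-− : ∀ x y z → (y - z) *ℚ x ≡ y *ℚ x - z *ℚ x
  *-distribʳ-− = solve-∀ ℚ-ring

⋆-identityˡ : ∀ (h : ℕ → ℚ) N → (oneℚ ⋆ h) N ≡ h N
⋆-identityˡ h N = trans (cong₂ _+ℚ_ (ℚ.*-identityˡ (h N)) (∑-zero N (λ i _ → ℚ.*-zeroˡ (h (N ∸ suc i)))))
                        (ℚ.+-identityʳ (h N))

private
  shift-below-* : ∀ {c} f (x : ℚ) {i} → i < c → shift 0ℚ c f i *ℚ x ≡ 0ℚ
  shift-below-* f x i<c = trans (cong (_*ℚ x) (shift-< 0ℚ f i<c)) (ℚ.*-zeroˡ x)

⋆-shiftˡ : ∀ c (f g : ℕ → ℚ) N → (shift 0ℚ c f ⋆ g) N ≡ shift 0ℚ c (f ⋆ g) N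
⋆-shiftˡ c f g N with c ℕ.≤? N
... | no c≰N = trans (∑-zero (suc N) (λ i i≤N → shift-below-* f (g (N ∸ i)) (ℕ.<-≤-trans i≤N (ℕ.≰⇒> c≰N))))
                     (sym (shift-< 0ℚ (f ⋆ g) (ℕ.≰⇒> c≰N)))
... | yes c≤N = begin
  ∑< (suc N) term                                 ≡⟨ cong (λ m → ∑< m term) length-split ⟩
  ∑< (c + suc (N ∸ c)) term                       ≡⟨ ∑-split c (suc (N ∸ c)) term ⟩
  ∑< c term +ℚ ∑[ j < suc (N ∸ c) ] term (c + j)  ≡⟨ cong₂ _+ℚ_ (∑-zero c below-c) (∑-cong (suc (N ∸ c)) from-c) ⟩
  0ℚ +ℚ (f ⋆ g) (N ∸ c)                           ≡⟨ ℚ.+-identityˡ _ ⟩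
  (f ⋆ g) (N ∸ c)                                 ≡⟨ shift-≥ 0ℚ (f ⋆ g) c≤N ⟨
  shift 0ℚ c (f ⋆ g) N                            ∎
  where
  open ≡-Reasoning
  term : ℕ → ℚ
  term i = shift 0ℚ c f i *ℚ g (N ∸ i)
  length-split : suc N ≡ c + suc (N ∸ c)
  length-split = trans (cong suc (sym (ℕ.m+[n∸m]≡n c≤N))) (sym (ℕ.+-suc c (N ∸ c)))
  below-c : ∀ i → i < c → term i ≡ 0ℚ
  below-c i = shift-below-* f (g (N ∸ i))
  from-c : ∀ j → j < suc (N ∸ c) → term (c + j) ≡ f j *ℚ g (N ∸ c ∸ j)
  from-c j _ = cong₂ _*ℚ_ (trans (shift-≥ 0ℚ f (ℕ.m≤m+n c j)) (cong f (ℕ.m+n∸m≡n c j)))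
                          (cong g (sym (ℕ.∸-+-assoc N c j)))

VanishesAbove : (ℕ → ℚ) → ℕ → Set
VanishesAbove f d = ∀ i → d < i → f i ≡ 0ℚ

private
  <-∸ : ∀ {i b N} → i + b < N → b < N ∸ i
  <-∸ {i} {b} {N} i+b<N = ℕ.m+n≤o⇒m≤o∸n (suc b) (subst (λ m → suc m ≤ N) (ℕ.+-comm i b) i+b<N)

⋆-vanishes : ∀ {f g a b} → VanishesAbove f a → VanishesAbove g b → VanishesAbove (f ⋆ g) (a + b)
⋆-vanishes {f} {g} {a} {b} f-vanishes g-vanishes N a+b<N = ∑-zero (suc N) term-zero
  where
  term-zero : ∀ i → i < suc N → f i *ℚ g (N ∸ i) ≡ 0ℚ
  term-zero i _ with a ℕ.<? i
  ... | yes a<i = trans (cong (_*ℚ g (N ∸ i)) (f-vanishes i a<i)) (ℚ.*-zeroˡ (g (N ∸ i)))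
  ... | no  a≮i =
    trans (cong (f i *ℚ_) (g-vanishes (N ∸ i) (<-∸ (ℕ.≤-<-trans (ℕ.+-monoˡ-≤ b (ℕ.≮⇒≥ a≮i)) a+b<N))))
          (ℚ.*-zeroʳ (f i))

⋆-top : ∀ {f g a b} → VanishesAbove f a → VanishesAbove g b → (f ⋆ g) (a + b) ≡ f a *ℚ g b
⋆-top {f} {g} {a} {b} f-vanishes g-vanishes =
  trans (∑-single (suc (a + b)) a (λ i → f i *ℚ g (a + b ∸ i)) (s≤s (ℕ.m≤m+n a b)) others)
        (cong (λ m → f a *ℚ g m) (ℕ.m+n∸m≡n a b))
  where
  others : ∀ i → i < suc (a + b) → i ≢ a → f i *ℚ g (a + b ∸ i) ≡ 0ℚ
  others i _ i≢a with ℕ.<-cmp i a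
  ... | tri< i<a _ _ = trans (cong (f i *ℚ_) (g-vanishes (a + b ∸ i) (<-∸ (ℕ.+-monoˡ-< b i<a))))
                             (ℚ.*-zeroʳ (f i))
  ... | tri≈ _ i≡a _ = contradiction i≡a i≢a
  ... | tri> _ _ a<i = trans (cong (_*ℚ g (a + b ∸ i)) (f-vanishes i a<i)) (ℚ.*-zeroˡ (g (a + b ∸ i)))

⋆-nonneg : ∀ {f g : ℕ → ℚ} → (∀ i → 0ℚ ≤ℚ f i) → (∀ i → 0ℚ ≤ℚ g i) → ∀ N → 0ℚ ≤ℚ (f ⋆ g) N
⋆-nonneg f≥0 g≥0 N = ∑-nonneg (suc N) (λ i _ → *-nonneg (f≥0 i) (g≥0 (N ∸ i)))

⋆-pos : ∀ {f g : ℕ → ℚ} → (∀ i → 0ℚ ≤ℚ f i) → (∀ i → 0ℚ ≤ℚ g i) → ∀ {N} → 0ℚ <ℚ f N → 0ℚ <ℚ g 0 →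
        0ℚ <ℚ (f ⋆ g) N
⋆-pos {f} {g} f≥0 g≥0 {N} fN>0 g0>0 =
  ∑-pos (suc N) N (λ i _ → *-nonneg (f≥0 i) (g≥0 (N ∸ i))) (ℕ.n<1+n N)
        (subst (λ m → 0ℚ <ℚ f N *ℚ g m) (sym (ℕ.n∸n≡0 N)) (*-pos fN>0 g0>0))

-- Polynomials

coeff : Poly → ℕ → ℚ
coeff []      _       = 0ℚ
coeff (c ∷ _) zero    = c
coeff (_ ∷ p) (suc i) = coeff p i

DegreeAtMost : Poly → ℕ → Set
DegreeAtMost p = VanishesAbove (coeff p)

addP : Poly → Poly → Poly
addP []      q       = q
addP (c ∷ p) []      = c ∷ p
addP (c ∷ p) (d ∷ q) = (c +ℚ d) ∷ addP p q

mulP : Poly → Poly → Poly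
mulP []      q = []
mulP (c ∷ p) q = addP (map (c *ℚ_) q) (0ℚ ∷ mulP p q)

sumP : List Poly → Poly
sumP = foldr addP []

evalPoly-addP : ∀ p q x → evalPoly (addP p q) x ≡ evalPoly p x +ℚ evalPoly q x
evalPoly-addP []      q       x = sym (ℚ.+-identityˡ _)
evalPoly-addP (c ∷ p) []      x = sym (ℚ.+-identityʳ _)
evalPoly-addP (c ∷ p) (d ∷ q) x =
  trans (cong (λ v → (c +ℚ d) +ℚ x *ℚ v) (evalPoly-addP p q x)) (regroup c d x (evalPoly p x) (evalPoly q x))
  where
  regroup : ∀ c d x u v → (c +ℚ d) +ℚ x *ℚ (u +ℚ v) ≡ (c +ℚ x *ℚ u) +ℚ (d +ℚ x *ℚ v)
  regroup = solve-∀ ℚ-ring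

evalPoly-scale : ∀ c q x → evalPoly (map (c *ℚ_) q) x ≡ c *ℚ evalPoly q x
evalPoly-scale c []      x = sym (ℚ.*-zeroʳ c)
evalPoly-scale c (d ∷ q) x =
  trans (cong (λ v → c *ℚ d +ℚ x *ℚ v) (evalPoly-scale c q x)) (regroup c d x (evalPoly q x))
  where
  regroup : ∀ c d x u → c *ℚ d +ℚ x *ℚ (c *ℚ u) ≡ c *ℚ (d +ℚ x *ℚ u)
  regroup = solve-∀ ℚ-ring

evalPoly-mulP : ∀ p q x → evalPoly (mulP p q) x ≡ evalPoly p x *ℚ evalPoly q x
evalPoly-mulP []      q x = sym (ℚ.*-zeroˡ (evalPoly q x))
evalPoly-mulP (c ∷ p) q x = begin
  evalPoly (addP (map (c *ℚ_) q) (0ℚ ∷ mulP p q)) x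
    ≡⟨ evalPoly-addP (map (c *ℚ_) q) (0ℚ ∷ mulP p q) x ⟩
  evalPoly (map (c *ℚ_) q) x +ℚ (0ℚ +ℚ x *ℚ evalPoly (mulP p q) x)
    ≡⟨ cong₂ (λ u v → u +ℚ (0ℚ +ℚ x *ℚ v)) (evalPoly-scale c q x) (evalPoly-mulP p q x) ⟩
  c *ℚ evalPoly q x +ℚ (0ℚ +ℚ x *ℚ (evalPoly p x *ℚ evalPoly q x))
    ≡⟨ regroup c x (evalPoly p x) (evalPoly q x) ⟩
  (c +ℚ x *ℚ evalPoly p x) *ℚ evalPoly q x
    ∎
  where
  open ≡-Reasoning
  regroup : ∀ c x u v → c *ℚ v +ℚ (0ℚ +ℚ x *ℚ (u *ℚ v)) ≡ (c +ℚ x *ℚ u) *ℚ v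
  regroup = solve-∀ ℚ-ring

evalPoly-sumP : ∀ ps x → evalPoly (sumP ps) x ≡ sumℚ (map (λ p → evalPoly p x) ps)
evalPoly-sumP []       x = refl
evalPoly-sumP (p ∷ ps) x = trans (evalPoly-addP p (sumP ps) x) (cong (evalPoly p x +ℚ_) (evalPoly-sumP ps x))

evalPoly-vanishing : ∀ p x → (∀ i → coeff p i ≡ 0ℚ) → evalPoly p x ≡ 0ℚ
evalPoly-vanishing []      x _   = refl
evalPoly-vanishing (c ∷ p) x p≡0 =
  trans (cong₂ (λ u v → u +ℚ x *ℚ v) (p≡0 0) (evalPoly-vanishing p x (p≡0 ∘ suc)))
        (trans (cong (0ℚ +ℚ_) (ℚ.*-zeroʳ x)) (ℚ.+-identityˡ 0ℚ))

evalPoly-take : ∀ m p x → (∀ i → m ≤ i → coeff p i ≡ 0ℚ) → evalPoly (take m p) x ≡ evalPoly p x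
evalPoly-take zero    p       x p≡0 = sym (evalPoly-vanishing p x (λ i → p≡0 i z≤n))
evalPoly-take (suc m) []      x _   = refl
evalPoly-take (suc m) (c ∷ p) x p≡0 =
  cong (λ v → c +ℚ x *ℚ v) (evalPoly-take m p x (λ i m≤i → p≡0 (suc i) (s≤s m≤i)))

coeff-addP : ∀ p q i → coeff (addP p q) i ≡ coeff p i +ℚ coeff q i
coeff-addP []      q       i       = sym (ℚ.+-identityˡ _)
coeff-addP (c ∷ p) []      i       = sym (ℚ.+-identityʳ _)
coeff-addP (c ∷ p) (d ∷ q) zero    = refl
coeff-addP (c ∷ p) (d ∷ q) (suc i) = coeff-addP p q i

coeff-scale : ∀ c q i → coeff (map (c *ℚ_) q) i ≡ c *ℚ coeff q i
coeff-scale c []      i       = sym (ℚ.*-zeroʳ c)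
coeff-scale c (d ∷ q) zero    = refl
coeff-scale c (d ∷ q) (suc i) = coeff-scale c q i

coeff-mulP : ∀ p q i → coeff (mulP p q) i ≡ (coeff p ⋆ coeff q) i
coeff-mulP []      q i       = sym (∑-zero (suc i) (λ j _ → ℚ.*-zeroˡ (coeff q (i ∸ j))))
coeff-mulP (c ∷ p) q zero    = trans (coeff-addP (map (c *ℚ_) q) _ 0) (cong (_+ℚ 0ℚ) (coeff-scale c q 0))
coeff-mulP (c ∷ p) q (suc i) =
  trans (coeff-addP (map (c *ℚ_) q) _ (suc i)) (cong₂ _+ℚ_ (coeff-scale c q (suc i)) (coeff-mulP p q i))

coeff-sumP : ∀ ps i → coeff (sumP ps) i ≡ sumℚ (map (λ p → coeff p i) ps)
coeff-sumP []       i = refl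
coeff-sumP (p ∷ ps) i = trans (coeff-addP p (sumP ps) i) (cong (coeff p i +ℚ_) (coeff-sumP ps i))

mulP-degree : ∀ p q {a b} → DegreeAtMost p a → DegreeAtMost q b → DegreeAtMost (mulP p q) (a + b)
mulP-degree p q p≤a q≤b i a+b<i = trans (coeff-mulP p q i) (⋆-vanishes p≤a q≤b i a+b<i)

mulP-top : ∀ p q {a b} → DegreeAtMost p a → DegreeAtMost q b → coeff (mulP p q) (a + b) ≡ coeff p a *ℚ coeff q b
mulP-top p q {a} {b} p≤a q≤b = trans (coeff-mulP p q (a + b)) (⋆-top p≤a q≤b)

DegreeAtMost-mono : ∀ p {a b} → DegreeAtMost p a → a ≤ b → DegreeAtMost p b
DegreeAtMost-mono p p≤a a≤b i b<i = p≤a i (ℕ.≤-<-trans a≤b b<i)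

coeff-nonneg-above : ∀ p {a b} → DegreeAtMost p a → 0ℚ ≤ℚ coeff p a → a ≤ b → 0ℚ ≤ℚ coeff p b
coeff-nonneg-above p {a} {b} p≤a pa≥0 a≤b with ℕ.m≤n⇒m<n∨m≡n a≤b
... | inj₁ a<b  = ℚ.≤-reflexive (sym (p≤a b a<b))
... | inj₂ refl = pa≥0

take-last : ∀ d p → coeff p d ≢ 0ℚ → length (take (suc d) p) ≡ suc d × last (take (suc d) p) ≡ just (coeff p d)
take-last zero    []          p[d]≢0 = contradiction refl p[d]≢0
take-last zero    (c ∷ p)     _      = refl , refl
take-last (suc d) []          p[d]≢0 = contradiction refl p[d]≢0
take-last (suc d) (c ∷ [])    p[d]≢0 = contradiction refl p[d]≢0
take-last (suc d) (c ∷ y ∷ p) p[d]≢0 with take-last d (y ∷ p) p[d]≢0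
... | length≡ , last≡ = cong suc length≡ , last≡

take-HasDegree : ∀ d p → coeff p d ≢ 0ℚ → HasDegree (take (suc d) p) d
take-HasDegree d p p[d]≢0 with take-last d p p[d]≢0
... | length≡ , last≡ = length≡ , λ c last≡c → subst (_≢ 0ℚ) (just-injective (trans (sym last≡) last≡c)) p[d]≢0

recip : ℕ → ℚ
recip j = 1/ fromℤ (+ suc j)

suc*recip : ∀ j → (1ℚ +ℚ fromℤ (+ j)) *ℚ recip j ≡ 1ℚ
suc*recip j = trans (cong (_*ℚ recip j) (sym (fromℤ-suc (+ j)))) (ℚ.*-inverseʳ (fromℤ (+ suc j)))

multichooseFactor : ℕ → Poly
multichooseFactor j = fromℤ (+ j) *ℚ recip j ∷ recip j ∷ []

-- multichoose j = ∏_{i<j} (i + x)/(i + 1) evaluates at x to x(x+1)⋯(x+j-1)/j!, the coefficient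
-- of q^(jn) in (1 - q^n)^(-x).
multichoose : ℕ → Poly
multichoose zero    = 1ℚ ∷ []
multichoose (suc j) = mulP (multichoose j) (multichooseFactor j)

multichoose-zero : ∀ x → evalPoly (multichoose 0) x ≡ 1ℚ
multichoose-zero x = trans (cong (1ℚ +ℚ_) (ℚ.*-zeroʳ x)) (ℚ.+-identityʳ 1ℚ)

multichoose-suc : ∀ j x →
  evalPoly (multichoose (suc j)) x ≡ evalPoly (multichoose j) x *ℚ ((fromℤ (+ j) +ℚ x) *ℚ recip j)
multichoose-suc j x =
  trans (evalPoly-mulP (multichoose j) (multichooseFactor j) x)
        (cong (evalPoly (multichoose j) x *ℚ_) (linear (fromℤ (+ j)) (recip j) x))
  where
  linear : ∀ a u x → a *ℚ u +ℚ x *ℚ (u +ℚ x *ℚ 0ℚ) ≡ (a +ℚ x) *ℚ u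
  linear = solve-∀ ℚ-ring

multichoose-shift : ∀ j x → evalPoly (multichoose (suc j)) x ≡ x *ℚ recip j *ℚ evalPoly (multichoose j) (1ℚ +ℚ x)
multichoose-shift zero x = begin
  evalPoly (multichoose 1) x                            ≡⟨ multichoose-suc 0 x ⟩
  evalPoly (multichoose 0) x *ℚ ((0ℚ +ℚ x) *ℚ recip 0)  ≡⟨ cong (_*ℚ ((0ℚ +ℚ x) *ℚ recip 0)) (multichoose-zero x) ⟩
  1ℚ *ℚ ((0ℚ +ℚ x) *ℚ recip 0)                          ≡⟨ regroup x (recip 0) ⟩
  x *ℚ recip 0 *ℚ 1ℚ                                    ≡⟨ cong (x *ℚ recip 0 *ℚ_) (multichoose-zero (1ℚ +ℚ x)) ⟨
  x *ℚ recip 0 *ℚ evalPoly (multichoose 0) (1ℚ +ℚ x)    ∎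
  where
  open ≡-Reasoning
  regroup : ∀ x u → 1ℚ *ℚ ((0ℚ +ℚ x) *ℚ u) ≡ x *ℚ u *ℚ 1ℚ
  regroup = solve-∀ ℚ-ring
multichoose-shift (suc j) x = begin
  evalPoly (multichoose (2 + j)) x
    ≡⟨ multichoose-suc (suc j) x ⟩
  evalPoly (multichoose (suc j)) x *ℚ ((fromℤ (+ suc j) +ℚ x) *ℚ recip (suc j))
    ≡⟨ cong₂ (λ m c → m *ℚ ((c +ℚ x) *ℚ recip (suc j))) (multichoose-shift j x) (fromℤ-suc (+ j)) ⟩
  x *ℚ recip j *ℚ B *ℚ ((1ℚ +ℚ a +ℚ x) *ℚ recip (suc j))
    ≡⟨ regroup x (recip j) (recip (suc j)) a B ⟩
  x *ℚ recip (suc j) *ℚ (B *ℚ ((a +ℚ (1ℚ +ℚ x)) *ℚ recip j))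
    ≡⟨ cong (x *ℚ recip (suc j) *ℚ_) (multichoose-suc j (1ℚ +ℚ x)) ⟨
  x *ℚ recip (suc j) *ℚ evalPoly (multichoose (suc j)) (1ℚ +ℚ x)
    ∎
  where
  open ≡-Reasoning
  a : ℚ
  a = fromℤ (+ j)
  B : ℚ
  B = evalPoly (multichoose j) (1ℚ +ℚ x)
  regroup : ∀ x u u′ a B →
    x *ℚ u *ℚ B *ℚ ((1ℚ +ℚ a +ℚ x) *ℚ u′) ≡ x *ℚ u′ *ℚ (B *ℚ ((a +ℚ (1ℚ +ℚ x)) *ℚ u))
  regroup = solve-∀ ℚ-ring

multichoose-pascal : ∀ j x →
  evalPoly (multichoose (suc j)) (1ℚ +ℚ x) ≡ evalPoly (multichoose (suc j)) x +ℚ evalPoly (multichoose j) (1ℚ +ℚ x)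
multichoose-pascal j x = begin
  evalPoly (multichoose (suc j)) (1ℚ +ℚ x)          ≡⟨ multichoose-suc j (1ℚ +ℚ x) ⟩
  B *ℚ ((a +ℚ (1ℚ +ℚ x)) *ℚ recip j)                ≡⟨ split-off x (recip j) a B ⟩
  B *ℚ ((1ℚ +ℚ a) *ℚ recip j) +ℚ x *ℚ recip j *ℚ B  ≡⟨ cong (λ c → B *ℚ c +ℚ x *ℚ recip j *ℚ B) (suc*recip j) ⟩
  B *ℚ 1ℚ +ℚ x *ℚ recip j *ℚ B                      ≡⟨ swap x (recip j) B ⟩
  x *ℚ recip j *ℚ B +ℚ B                            ≡⟨ cong (_+ℚ B) (multichoose-shift j x) ⟨
  evalPoly (multichoose (suc j)) x +ℚ B             ∎
  where
  open ≡-Reasoning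
  a : ℚ
  a = fromℤ (+ j)
  B : ℚ
  B = evalPoly (multichoose j) (1ℚ +ℚ x)
  split-off : ∀ x u a B → B *ℚ ((a +ℚ (1ℚ +ℚ x)) *ℚ u) ≡ B *ℚ ((1ℚ +ℚ a) *ℚ u) +ℚ x *ℚ u *ℚ B
  split-off = solve-∀ ℚ-ring
  swap : ∀ x u B → B *ℚ 1ℚ +ℚ x *ℚ u *ℚ B ≡ x *ℚ u *ℚ B +ℚ B
  swap = solve-∀ ℚ-ring

multichoose-at-0 : ∀ j → evalPoly (multichoose j) 0ℚ ≡ oneℚ j
multichoose-at-0 zero    = multichoose-zero 0ℚ
multichoose-at-0 (suc j) =
  trans (multichoose-shift j 0ℚ)
        (trans (cong (_*ℚ evalPoly (multichoose j) (1ℚ +ℚ 0ℚ)) (ℚ.*-zeroˡ (recip j)))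
               (ℚ.*-zeroˡ (evalPoly (multichoose j) (1ℚ +ℚ 0ℚ))))

multichooseFactor-degree : ∀ j → DegreeAtMost (multichooseFactor j) 1
multichooseFactor-degree j (suc zero)    (s≤s ())
multichooseFactor-degree j (suc (suc i)) _ = refl

multichoose-degree : ∀ j → DegreeAtMost (multichoose j) j
multichoose-degree zero    (suc i) _ = refl
multichoose-degree (suc j) =
  subst (DegreeAtMost (multichoose (suc j))) (ℕ.+-comm j 1)
    (mulP-degree (multichoose j) (multichooseFactor j) (multichoose-degree j) (multichooseFactor-degree j))

multichoose-leading : ∀ j → 0ℚ <ℚ coeff (multichoose j) j
multichoose-leading zero    = ℚ.positive⁻¹ 1ℚ
multichoose-leading (suc j) =
  subst (λ d → 0ℚ <ℚ coeff (multichoose (suc j)) d) (ℕ.+-comm j 1)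
    (subst (0ℚ <ℚ_) (sym (mulP-top (multichoose j) (multichooseFactor j)
                                   (multichoose-degree j) (multichooseFactor-degree j)))
      (*-pos (multichoose-leading j) (ℚ.positive⁻¹ (recip j))))

-- The coefficients of (1 - q^n)^(-k)

∣⇔∣∸ : ∀ {d N} → d ≤ N → (d ∣ N) ⇔ (d ∣ N ∸ d)
∣⇔∣∸ {d} d≤N = mk⇔ (λ d∣N → ∣m+n∣m⇒∣n (subst (d ∣_) (sym (ℕ.m+[n∸m]≡n d≤N)) d∣N) ∣-refl)
                   (λ d∣N∸d → ∣m∸n∣n⇒∣m d d≤N d∣N∸d ∣-refl)

/-∸ : ∀ n {N} .{{_ : ℕ.NonZero n}} → n ≤ N → N / n ≡ suc ((N ∸ n) / n)
/-∸ n {N} n≤N = trans (sym (ℕ.suc-pred (N / n) {{ℕ.>-nonZero (m≥n⇒m/n>0 n≤N)}}))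
                      (cong suc (sym ([m∸n]/n≡m/n∸1 N n)))

oneP : ℕ → Poly
oneP zero    = 1ℚ ∷ []
oneP (suc _) = []

evalPoly-oneP : ∀ x N → evalPoly (oneP N) x ≡ oneℚ N
evalPoly-oneP x zero    = multichoose-zero x
evalPoly-oneP x (suc N) = refl

evalAt : (ℕ → Poly) → ℚ → ℕ → ℚ
evalAt F x N = evalPoly (F N) x

-- The coefficients of (1 - q^n)^(-x) as polynomials in x.  The factor n = 0 never occurs;
-- it is given the neutral value oneP.
binomialSeries : ℕ → ℕ → Poly
binomialSeries zero      = oneP
binomialSeries (suc m) N = if does (suc m ∣? N) then multichoose (N / suc m) else []

binomialSeries-below : ∀ m N → N < suc m → binomialSeries (suc m) N ≡ oneP N
binomialSeries-below m zero    _   rewrite dec-true (suc m ∣? 0) (suc m ∣0) = refl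
binomialSeries-below m (suc N) N<n rewrite dec-false (suc m ∣? suc N) (ℕ.<⇒≱ N<n ∘ ∣⇒≤) = refl

binomialSeries-at-0 : ∀ m N → evalPoly (binomialSeries (suc m) N) 0ℚ ≡ oneℚ N
binomialSeries-at-0 m zero rewrite binomialSeries-below m 0 (s≤s z≤n) = multichoose-zero 0ℚ
binomialSeries-at-0 m (suc N) with suc m ∣? suc N
... | no  n∤N rewrite dec-false (suc m ∣? suc N) n∤N = refl
... | yes n∣N rewrite dec-true (suc m ∣? suc N) n∣N =
  trans (multichoose-at-0 (suc N / suc m)) (oneℚ-≢0 (ℕ.>⇒≢ (m≥n⇒m/n>0 {suc N} {suc m} (∣⇒≤ n∣N))))

binomialSeries-pascal-≥ : ∀ m x {N} → suc m ≤ N →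
  evalAt (binomialSeries (suc m)) (1ℚ +ℚ x) N
    ≡ evalAt (binomialSeries (suc m)) x N +ℚ evalAt (binomialSeries (suc m)) (1ℚ +ℚ x) (N ∸ suc m)
binomialSeries-pascal-≥ m x {N} n≤N with suc m ∣? N | suc m ∣? (N ∸ suc m)
... | yes n∣N | yes n∣N∸n
  rewrite dec-true (suc m ∣? N) n∣N | dec-true (suc m ∣? (N ∸ suc m)) n∣N∸n | /-∸ (suc m) n≤N =
  multichoose-pascal ((N ∸ suc m) / suc m) x
... | no  n∤N | no  n∤N∸n
  rewrite dec-false (suc m ∣? N) n∤N | dec-false (suc m ∣? (N ∸ suc m)) n∤N∸n = sym (ℚ.+-identityˡ 0ℚ)
... | yes n∣N | no  n∤N∸n = contradiction (Equivalence.to (∣⇔∣∸ n≤N) n∣N) n∤N∸n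
... | no  n∤N | yes n∣N∸n = contradiction (Equivalence.from (∣⇔∣∸ n≤N) n∣N∸n) n∤N

binomialSeries-pascal : ∀ m x N →
  evalAt (binomialSeries (suc m)) (1ℚ +ℚ x) N
    ≡ evalAt (binomialSeries (suc m)) x N +ℚ shift 0ℚ (suc m) (evalAt (binomialSeries (suc m)) (1ℚ +ℚ x)) N
binomialSeries-pascal m x N with N ℕ.<? suc m
... | yes N<n rewrite binomialSeries-below m N N<n | shift-< 0ℚ (evalAt (binomialSeries (suc m)) (1ℚ +ℚ x)) N<n =
  trans (evalPoly-oneP (1ℚ +ℚ x) N) (sym (trans (cong (_+ℚ 0ℚ) (evalPoly-oneP x N)) (ℚ.+-identityʳ (oneℚ N))))
... | no  N≮n rewrite shift-≥ 0ℚ (evalAt (binomialSeries (suc m)) (1ℚ +ℚ x)) (ℕ.≮⇒≥ N≮n) =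
  binomialSeries-pascal-≥ m x (ℕ.≮⇒≥ N≮n)

fromℤ-geomQ : ∀ m N → fromℤ (geomQ (suc m) N) ≡ oneℚ N +ℚ shift 0ℚ (suc m) (fromℤ ∘ geomQ (suc m)) N
fromℤ-geomQ m N with N ℕ.<? suc m
... | yes N<n rewrite shift-< 0ℚ (fromℤ ∘ geomQ (suc m)) N<n =
  trans (below N N<n) (sym (ℚ.+-identityʳ (oneℚ N)))
  where
  below : ∀ N → N < suc m → fromℤ (geomQ (suc m) N) ≡ oneℚ N
  below zero    _   rewrite dec-true (suc m ∣? 0) (suc m ∣0) = refl
  below (suc N) N<n rewrite dec-false (suc m ∣? suc N) (ℕ.<⇒≱ N<n ∘ ∣⇒≤) = refl
... | no  N≮n = begin
  fromℤ (geomQ (suc m) N)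
    ≡⟨ cong (λ b → fromℤ (if b then + 1 else + 0)) (does-⇔ (∣⇔∣∸ n≤N) (suc m ∣? N) (suc m ∣? (N ∸ suc m))) ⟩
  fromℤ (geomQ (suc m) (N ∸ suc m))
    ≡⟨ ℚ.+-identityˡ _ ⟨
  0ℚ +ℚ fromℤ (geomQ (suc m) (N ∸ suc m))
    ≡⟨ cong₂ _+ℚ_ (oneℚ-≢0 (ℕ.>⇒≢ (ℕ.<-≤-trans (s≤s z≤n) n≤N))) (shift-≥ 0ℚ (fromℤ ∘ geomQ (suc m)) n≤N) ⟨
  oneℚ N +ℚ shift 0ℚ (suc m) (fromℤ ∘ geomQ (suc m)) N
    ∎
  where
  open ≡-Reasoning
  n≤N : suc m ≤ N
  n≤N = ℕ.≮⇒≥ N≮n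

fromℤ-δ : ∀ c N → fromℤ (if N ≡ᵇ c then + 1 else + 0) ≡ shift 0ℚ c oneℚ N
fromℤ-δ c N with N ≡ᵇ c | ℕ.≡ᵇ⇒≡ N c | ℕ.≡⇒≡ᵇ N c
... | true  | N≡c | _ rewrite N≡c tt = sym (trans (shift-≥ 0ℚ oneℚ (ℕ.≤-refl {c})) (cong oneℚ (ℕ.n∸n≡0 c)))
... | false | _ | N≢c with c ℕ.≤? N
...   | yes c≤N = sym (trans (shift-≥ 0ℚ oneℚ c≤N) (oneℚ-≢0 (ℕ.m>n⇒m∸n≢0 (ℕ.≤∧≢⇒< c≤N (N≢c ∘ sym)))))
...   | no  c≰N = sym (shift-< 0ℚ oneℚ (ℕ.≰⇒> c≰N))

fromℤ-oneMinusQ : ∀ n N → fromℤ (oneMinusQ n N) ≡ oneℚ N - shift 0ℚ n oneℚ N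
fromℤ-oneMinusQ n N =
  trans (fromℤ-- (if N ≡ᵇ 0 then + 1 else + 0) (if N ≡ᵇ n then + 1 else + 0))
        (cong₂ _-_ (fromℤ-δ 0 N) (fromℤ-δ n N))

⋆-geomQ : ∀ m (h : ℕ → ℚ) N →
  ((fromℤ ∘ geomQ (suc m)) ⋆ h) N ≡ h N +ℚ shift 0ℚ (suc m) ((fromℤ ∘ geomQ (suc m)) ⋆ h) N
⋆-geomQ m h N =
  trans (⋆-cong {g = h} (fromℤ-geomQ m) (λ _ → refl) N)
        (trans (⋆-distribʳ-+ oneℚ (shift 0ℚ (suc m) (fromℤ ∘ geomQ (suc m))) h N)
               (cong₂ _+ℚ_ (⋆-identityˡ h N) (⋆-shiftˡ (suc m) (fromℤ ∘ geomQ (suc m)) h N)))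

⋆-oneMinusQ : ∀ n (h : ℕ → ℚ) N → ((fromℤ ∘ oneMinusQ n) ⋆ h) N ≡ h N - shift 0ℚ n h N
⋆-oneMinusQ n h N =
  trans (⋆-cong {g = h} (fromℤ-oneMinusQ n) (λ _ → refl) N)
        (trans (⋆-distribʳ-− oneℚ (shift 0ℚ n oneℚ) h N)
               (cong₂ _-_ (⋆-identityˡ h N) (trans (⋆-shiftˡ n oneℚ h N) (shift-cong 0ℚ n N (⋆-identityˡ h)))))

Represents : (ℕ → Poly) → (ℤ → Series) → Set
Represents F c = ∀ k N → evalPoly (F N) (fromℤ k) ≡ fromℤ (c k N)

-- By Pascal's rule, E (1 + x) is the unique solution A of A = E x + q^n A, as is the product of
-- 1/(1 - q^n) with E x; solving for E x gives its product with 1 - q^n.  Then induct on k ∈ ℤ.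
binomialSeries-represents : ∀ m → Represents (binomialSeries (suc m)) (invPowOneMinusQ (suc m))
binomialSeries-represents m = represents
  where
  n : ℕ
  n = suc m

  E : ℚ → ℕ → ℚ
  E = evalAt (binomialSeries n)

  up : ∀ x {h} → (∀ N → E x N ≡ h N) → ∀ N → E (1ℚ +ℚ x) N ≡ ((fromℤ ∘ geomQ n) ⋆ h) N
  up x {h} E≡h = shift-fixpoint-unique {h = h} (s≤s z≤n)
    (λ N → trans (binomialSeries-pascal m x N) (cong (_+ℚ shift 0ℚ n (E (1ℚ +ℚ x)) N) (E≡h N)))
    (⋆-geomQ m h)

  down : ∀ x {h} → (∀ N → E (1ℚ +ℚ x) N ≡ h N) → ∀ N → E x N ≡ ((fromℤ ∘ oneMinusQ n) ⋆ h) N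
  down x {h} E≡h N = begin
    E x N                          ≡⟨ add-sub (E x N) s ⟩
    (E x N +ℚ s) - s               ≡⟨ cong (_- s) (binomialSeries-pascal m x N) ⟨
    E (1ℚ +ℚ x) N - s              ≡⟨ cong₂ _-_ (E≡h N) (shift-cong 0ℚ n N E≡h) ⟩
    h N - shift 0ℚ n h N           ≡⟨ ⋆-oneMinusQ n h N ⟨
    ((fromℤ ∘ oneMinusQ n) ⋆ h) N  ∎
    where
    open ≡-Reasoning
    s : ℚ
    s = shift 0ℚ n (E (1ℚ +ℚ x)) N
    add-sub : ∀ a b → a ≡ (a +ℚ b) - b
    add-sub = solve-∀ ℚ-ring

  up-ℤ : ∀ k {c} → (∀ N → E (fromℤ k) N ≡ fromℤ (c N)) →
         ∀ N → E (fromℤ (+ 1 ℤ.+ k)) N ≡ fromℤ (mulS (geomQ n) c N)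
  up-ℤ k {c} E≡c N = trans (cong (λ x → E x N) (fromℤ-suc k))
                            (trans (up (fromℤ k) E≡c N) (sym (fromℤ-mulS (geomQ n) c N)))

  down-ℤ : ∀ k {c} → (∀ N → E (fromℤ (+ 1 ℤ.+ k)) N ≡ fromℤ (c N)) →
           ∀ N → E (fromℤ k) N ≡ fromℤ (mulS (oneMinusQ n) c N)
  down-ℤ k {c} E≡c N = trans (down (fromℤ k) (λ M → trans (cong (λ x → E x M) (sym (fromℤ-suc k))) (E≡c M)) N)
                              (sym (fromℤ-mulS (oneMinusQ n) c N))

  represents : ∀ k N → E (fromℤ k) N ≡ fromℤ (invPowOneMinusQ n k N)
  represents (+ zero)     = binomialSeries-at-0 m
  represents (+ suc k)    = up-ℤ (+ k) (represents (+ k))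
  represents -[1+ zero ]  = down-ℤ -[1+ 0 ] (represents (+ 0))
  represents -[1+ suc k ] = down-ℤ -[1+ suc k ] (represents -[1+ k ])

-- Products over a tuple

infixl 7 _⋆ₚ_

_⋆ₚ_ : (ℕ → Poly) → (ℕ → Poly) → ℕ → Poly
(F ⋆ₚ H) N = sumP (applyUpTo (λ i → mulP (F i) (H (N ∸ i))) (suc N))

evalAt-⋆ₚ : ∀ F H x N → evalAt (F ⋆ₚ H) x N ≡ (evalAt F x ⋆ evalAt H x) N
evalAt-⋆ₚ F H x N =
  trans (evalPoly-sumP (applyUpTo term (suc N)) x)
        (trans (cong sumℚ (List.map-applyUpTo term (λ p → evalPoly p x) (suc N)))
               (∑-cong (suc N) (λ i _ → evalPoly-mulP (F i) (H (N ∸ i)) x)))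
  where
  term : ℕ → Poly
  term i = mulP (F i) (H (N ∸ i))

coeff-⋆ₚ : ∀ F H N d → coeff ((F ⋆ₚ H) N) d ≡ ∑[ i < suc N ] coeff (mulP (F i) (H (N ∸ i))) d
coeff-⋆ₚ F H N d =
  trans (coeff-sumP (applyUpTo term (suc N)) d) (cong sumℚ (List.map-applyUpTo term (λ p → coeff p d) (suc N)))
  where
  term : ℕ → Poly
  term i = mulP (F i) (H (N ∸ i))

⋆ₚ-represents : ∀ F H {f h} → Represents F f → Represents H h → Represents (F ⋆ₚ H) (λ k → mulS (f k) (h k))
⋆ₚ-represents F H {f} {h} F≈f H≈h k N =
  trans (evalAt-⋆ₚ F H (fromℤ k) N) (trans (⋆-cong (F≈f k) (H≈h k) N) (sym (fromℤ-mulS (f k) (h k) N)))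

productSeries : List ℕ → ℕ → Poly
productSeries []      = oneP
productSeries (n ∷ t) = binomialSeries n ⋆ₚ productSeries t

productSeries-represents : ∀ {t} → All (1 ≤_) t → Represents (productSeries t) (λ k → prodInv k t)
productSeries-represents []                   k N = evalPoly-oneP (fromℤ k) N
productSeries-represents {suc m ∷ t} (_ ∷ t≥1) =
  ⋆ₚ-represents (binomialSeries (suc m)) (productSeries t) (binomialSeries-represents m)
                (productSeries-represents t≥1)

diagonal : (ℕ → Poly) → ℕ → ℚ
diagonal F N = coeff (F N) N

record Triangular (F : ℕ → Poly) : Set where
  field
    degree          : ∀ N → DegreeAtMost (F N) N
    diagonal-nonneg : ∀ N → 0ℚ ≤ℚ diagonal F N

open Triangular

module _ {F H : ℕ → Poly} (F△ : Triangular F) (H△ : Triangular H) {N i} (i≤N : i ≤ N) where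

  private
    i+[N∸i]≡N : i + (N ∸ i) ≡ N
    i+[N∸i]≡N = ℕ.m+[n∸m]≡n i≤N

  ⋆ₚ-term-degree : DegreeAtMost (mulP (F i) (H (N ∸ i))) N
  ⋆ₚ-term-degree = subst (DegreeAtMost (mulP (F i) (H (N ∸ i)))) i+[N∸i]≡N
                         (mulP-degree (F i) (H (N ∸ i)) (degree F△ i) (degree H△ (N ∸ i)))

  ⋆ₚ-term-top : coeff (mulP (F i) (H (N ∸ i))) N ≡ diagonal F i *ℚ diagonal H (N ∸ i)
  ⋆ₚ-term-top = subst (λ d → coeff (mulP (F i) (H (N ∸ i))) d ≡ diagonal F i *ℚ diagonal H (N ∸ i)) i+[N∸i]≡N
                      (mulP-top (F i) (H (N ∸ i)) (degree F△ i) (degree H△ (N ∸ i)))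

module _ {F H : ℕ → Poly} (F△ : Triangular F) (H△ : Triangular H) where

  ⋆ₚ-diagonal : ∀ N → diagonal (F ⋆ₚ H) N ≡ (diagonal F ⋆ diagonal H) N
  ⋆ₚ-diagonal N = trans (coeff-⋆ₚ F H N N) (∑-cong (suc N) (λ i i<1+N → ⋆ₚ-term-top F△ H△ (ℕ.≤-pred i<1+N)))

  ⋆ₚ-triangular : Triangular (F ⋆ₚ H)
  ⋆ₚ-triangular .degree N d N<d =
    trans (coeff-⋆ₚ F H N d) (∑-zero (suc N) (λ i i<1+N → ⋆ₚ-term-degree F△ H△ (ℕ.≤-pred i<1+N) d N<d))
  ⋆ₚ-triangular .diagonal-nonneg N =
    subst (0ℚ ≤ℚ_) (sym (⋆ₚ-diagonal N)) (⋆-nonneg (diagonal-nonneg F△) (diagonal-nonneg H△) N)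

  ⋆ₚ-diagonal-pos : ∀ {N} → 0ℚ <ℚ diagonal F N → 0ℚ <ℚ diagonal H 0 → 0ℚ <ℚ diagonal (F ⋆ₚ H) N
  ⋆ₚ-diagonal-pos {N} F>0 H>0 =
    subst (0ℚ <ℚ_) (sym (⋆ₚ-diagonal N)) (⋆-pos (diagonal-nonneg F△) (diagonal-nonneg H△) F>0 H>0)

oneP-triangular : Triangular oneP
oneP-triangular .degree zero    (suc i) _ = refl
oneP-triangular .degree (suc N) i       _ = refl
oneP-triangular .diagonal-nonneg zero    = ℚ.<⇒≤ (ℚ.positive⁻¹ 1ℚ)
oneP-triangular .diagonal-nonneg (suc N) = ℚ.≤-refl

binomialSeries-triangular : ∀ n → Triangular (binomialSeries n)
binomialSeries-triangular zero    = oneP-triangular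
binomialSeries-triangular (suc m) = record { degree = proj₁ ∘ bounds ; diagonal-nonneg = proj₂ ∘ bounds }
  where
  bounds : ∀ N → DegreeAtMost (binomialSeries (suc m) N) N × 0ℚ ≤ℚ diagonal (binomialSeries (suc m)) N
  bounds N with suc m ∣? N
  ... | no  n∤N rewrite dec-false (suc m ∣? N) n∤N = (λ _ _ → refl) , ℚ.≤-refl
  ... | yes n∣N rewrite dec-true (suc m ∣? N) n∣N =
    DegreeAtMost-mono (multichoose j) (multichoose-degree j) j≤N ,
    coeff-nonneg-above (multichoose j) (multichoose-degree j) (ℚ.<⇒≤ (multichoose-leading j)) j≤N
    where
    j : ℕ
    j = N / suc m
    j≤N : j ≤ N
    j≤N = m/n≤m N (suc m)

binomialSeries-diagonal-0 : ∀ n → 0ℚ <ℚ diagonal (binomialSeries n) 0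
binomialSeries-diagonal-0 zero    = ℚ.positive⁻¹ 1ℚ
binomialSeries-diagonal-0 (suc m) rewrite binomialSeries-below m 0 (s≤s z≤n) = ℚ.positive⁻¹ 1ℚ

binomialSeries-1-diagonal-pos : ∀ N → 0ℚ <ℚ diagonal (binomialSeries 1) N
binomialSeries-1-diagonal-pos N rewrite dec-true (1 ∣? N) (1∣ N) | n/1≡n N = multichoose-leading N

productSeries-triangular : ∀ t → Triangular (productSeries t)
productSeries-triangular []      = oneP-triangular
productSeries-triangular (n ∷ t) = ⋆ₚ-triangular (binomialSeries-triangular n) (productSeries-triangular t)

productSeries-diagonal-0 : ∀ t → 0ℚ <ℚ diagonal (productSeries t) 0
productSeries-diagonal-0 []      = ℚ.positive⁻¹ 1ℚ
productSeries-diagonal-0 (n ∷ t) =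
  ⋆ₚ-diagonal-pos (binomialSeries-triangular n) (productSeries-triangular t)
                  (binomialSeries-diagonal-0 n) (productSeries-diagonal-0 t)

productSeries-diagonal-pos : ∀ t N → 0ℚ <ℚ diagonal (productSeries (1 ∷ t)) N
productSeries-diagonal-pos t N =
  ⋆ₚ-diagonal-pos (binomialSeries-triangular 1) (productSeries-triangular t)
                  (binomialSeries-1-diagonal-pos N) (productSeries-diagonal-0 t)

HasPolynomialCoefficients : ℕ → (ℤ → ℕ → ℤ) → Set
HasPolynomialCoefficients Th c =
  Σ (ℕ → Poly) λ P →
      ((k : ℤ) (n : ℕ) → evalPoly (P n) (ℤtoℚ k) ≡ ℤtoℚ (c k n))
    × ((n : ℕ) → Th ≤ n → HasDegree (P n) (n ∸ Th))
    × ((n : ℕ) → n < Th → IsZeroPoly (P n))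

-- R N may carry trailing zero coefficients beyond degree N - Th; truncation removes them.
polynomialCoefficients : ∀ {Th c} (R : ℕ → Poly) → Represents R c →
  (∀ N i → N < Th + i → coeff (R N) i ≡ 0ℚ) → (∀ N → Th ≤ N → 0ℚ <ℚ coeff (R N) (N ∸ Th)) →
  HasPolynomialCoefficients Th c
polynomialCoefficients {Th} {c} R R≈c R-vanishes R-leading = P , evaluates , hasDegree , vanishes
  where
  P : ℕ → Poly
  P N = take (suc N ∸ Th) (R N)

  evaluates : ∀ k N → evalPoly (P N) (ℤtoℚ k) ≡ ℤtoℚ (c k N)
  evaluates k N = begin
    evalPoly (P N) (ℤtoℚ k)   ≡⟨ cong (evalPoly (P N)) (ℤtoℚ≡fromℤ k) ⟩
    evalPoly (P N) (fromℤ k)  ≡⟨ evalPoly-take (suc N ∸ Th) (R N) (fromℤ k) (λ i → R-vanishes N i ∘ bound i) ⟩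
    evalPoly (R N) (fromℤ k)  ≡⟨ R≈c k N ⟩
    fromℤ (c k N)             ≡⟨ ℤtoℚ≡fromℤ (c k N) ⟨
    ℤtoℚ (c k N)              ∎
    where
    open ≡-Reasoning
    bound : ∀ i → suc N ∸ Th ≤ i → N < Th + i
    bound i le = ℕ.≤-trans (ℕ.m≤n+m∸n (suc N) Th) (ℕ.+-monoʳ-≤ Th le)

  hasDegree : ∀ N → Th ≤ N → HasDegree (P N) (N ∸ Th)
  hasDegree N Th≤N = subst (λ m → HasDegree (take m (R N)) (N ∸ Th)) (sym (ℕ.+-∸-assoc 1 Th≤N))
                           (take-HasDegree (N ∸ Th) (R N) (ℚ.<⇒≢ (R-leading N Th≤N) ∘ sym))

  vanishes : ∀ N → N < Th → IsZeroPoly (P N)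
  vanishes N N<Th = subst (λ m → IsZeroPoly (take m (R N))) (sym (ℕ.m≤n⇒m∸n≡0 N<Th)) []

-- Sums over increasing tuples

data IncreasingFrom : ℕ → List ℕ → Set where
  []  : ∀ {lo} → IncreasingFrom lo []
  _∷_ : ∀ {lo x t} → lo ≤ x → IncreasingFrom (suc x) t → IncreasingFrom lo (x ∷ t)

IncreasingFrom⇒All≥ : ∀ {lo t} → IncreasingFrom lo t → All (lo ≤_) t
IncreasingFrom⇒All≥ []            = []
IncreasingFrom⇒All≥ (lo≤x ∷ incr) = lo≤x ∷ All.map (ℕ.≤-trans lo≤x ∘ ℕ.<⇒≤) (IncreasingFrom⇒All≥ incr)

range : ℕ → ℕ → List ℕ
range lo zero    = []
range lo (suc a) = lo ∷ range (suc lo) a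

productSeries-range-diagonal-pos : ∀ {a} → 1 ≤ a → ∀ N → 0ℚ <ℚ diagonal (productSeries (range 1 a)) N
productSeries-range-diagonal-pos {suc a} _ = productSeries-diagonal-pos (range 2 a)

incTuples-increasing : ∀ a lo M → All (λ t → IncreasingFrom lo t × length t ≡ a) (incTuples a lo M)
incTuples-increasing zero    lo M = ([] , refl) ∷ []
incTuples-increasing (suc a) lo M =
  All.concat⁺ (All.map⁺ (All.applyUpTo⁺₂ (lo ℕ.+_) (suc M ∸ lo) λ i →
    All.map⁺ (All.map (λ (incr , length≡a) → ℕ.m≤m+n lo i ∷ incr , cong suc length≡a)
                      (incTuples-increasing a (suc (lo + i)) M))))

range∈incTuples : ∀ a lo M → a + lo ≤ suc M → range lo a ∈ incTuples a lo M
range∈incTuples zero    lo M _  = here refl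
range∈incTuples (suc a) lo M le =
  Any.concat⁺ (Any.map⁺ (Any.applyUpTo⁺ (lo ℕ.+_) {i = 0} first-block (ℕ.m<n⇒0<n∸m lo<1+M)))
  where
  a+1+lo≤1+M : a + suc lo ≤ suc M
  a+1+lo≤1+M = subst (_≤ suc M) (sym (ℕ.+-suc a lo)) le
  lo<1+M : lo < suc M
  lo<1+M = ℕ.<-≤-trans (ℕ.m≤n+m (suc lo) a) a+1+lo≤1+M
  first-block : range lo (suc a) ∈ map ((lo + 0) ∷_) (incTuples a (suc (lo + 0)) M)
  first-block = subst (λ x → range lo (suc a) ∈ map (x ∷_) (incTuples a (suc x) M)) (sym (ℕ.+-identityʳ lo))
    (Any.map⁺ (Any.map (cong (lo ∷_)) (range∈incTuples a (suc lo) M a+1+lo≤1+M)))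

module _ (w : ℕ → ℕ) (w-mono : w Preserves _≤_ ⟶ _≤_) where

  private
    range-minimal′ : ∀ {lo lo′ t} → IncreasingFrom lo t → lo′ ≤ lo →
                     sumℕ (map w (range lo′ (length t))) ≤ sumℕ (map w t)
    range-minimal′ []            _      = z≤n
    range-minimal′ (lo≤x ∷ incr) lo′≤lo =
      ℕ.+-mono-≤ (w-mono (ℕ.≤-trans lo′≤lo lo≤x)) (range-minimal′ incr (s≤s (ℕ.≤-trans lo′≤lo lo≤x)))

  sum-map-range-minimal : ∀ {lo t} → IncreasingFrom lo t → sumℕ (map w (range lo (length t))) ≤ sumℕ (map w t)
  sum-map-range-minimal incr = range-minimal′ incr ℕ.≤-refl

sum-range-minimal : ∀ {lo t} → IncreasingFrom lo t → sumℕ (range lo (length t)) ≤ sumℕ t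
sum-range-minimal {lo} {t} incr =
  subst₂ _≤_ (cong sumℕ (List.map-id (range lo (length t)))) (cong sumℕ (List.map-id t))
         (sum-map-range-minimal id id incr)

tupleCoeff : ℕ → (List ℕ → ℕ) → ℤ → ℕ → ℤ
tupleCoeff a σ k N = sumℤ (map (λ t → shiftCoeff (σ t) (prodInv k t) N) (incTuples a 1 N))

tupleSeries : ℕ → (List ℕ → ℕ) → ℕ → Poly
tupleSeries a σ N = sumP (map (λ t → shift [] (σ t) (productSeries t) N) (incTuples a 1 N))

shift-represents : ∀ F {c} → Represents F c →
  ∀ e k N → evalPoly (shift [] e F N) (fromℤ k) ≡ fromℤ (shiftCoeff e (c k) N)
shift-represents F {c} F≈c e k N =
  trans (shift-map [] F (λ p → evalPoly p (fromℤ k)) e N)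
        (trans (shift-cong 0ℚ e N (F≈c k)) (sym (shift-map (+ 0) (c k) fromℤ e N)))

module _ {F : ℕ → Poly} (F△ : Triangular F) {e N : ℕ} where

  shift-coeff-vanishes : ∀ i → N < e + i → coeff (shift [] e F N) i ≡ 0ℚ
  shift-coeff-vanishes i N<e+i with e ℕ.≤? N
  ... | no  e≰N rewrite shift-< [] F (ℕ.≰⇒> e≰N) = refl
  ... | yes e≤N rewrite shift-≥ [] F e≤N =
    degree F△ (N ∸ e) i (subst (N ∸ e <_) (ℕ.m+n∸m≡n e i) (ℕ.∸-monoˡ-< N<e+i e≤N))

  shift-coeff-nonneg : ∀ i → N ≤ e + i → 0ℚ ≤ℚ coeff (shift [] e F N) i
  shift-coeff-nonneg i N≤e+i with e ℕ.≤? N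
  ... | no  e≰N rewrite shift-< [] F (ℕ.≰⇒> e≰N) = ℚ.≤-refl
  ... | yes e≤N rewrite shift-≥ [] F e≤N =
    coeff-nonneg-above (F (N ∸ e)) (degree F△ (N ∸ e)) (diagonal-nonneg F△ (N ∸ e)) (ℕ.m≤n+o⇒m∸n≤o N e N≤e+i)

shift-coeff-diagonal : ∀ F {e N} → e ≤ N → coeff (shift [] e F N) (N ∸ e) ≡ diagonal F (N ∸ e)
shift-coeff-diagonal F {e} {N} e≤N = cong (λ p → coeff p (N ∸ e)) (shift-≥ [] F e≤N)

module _ (a : ℕ) (σ : List ℕ → ℕ) where

  private
    term : ℕ → List ℕ → Poly
    term N t = shift [] (σ t) (productSeries t) N

    coeff-tupleSeries : ∀ N i → coeff (tupleSeries a σ N) i ≡ sumℚ (map (λ t → coeff (term N t) i) (incTuples a 1 N))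
    coeff-tupleSeries N i =
      trans (coeff-sumP (map (term N) (incTuples a 1 N)) i) (cong sumℚ (sym (List.map-∘ (incTuples a 1 N))))

  tupleSeries-represents : Represents (tupleSeries a σ) (tupleCoeff a σ)
  tupleSeries-represents k N = begin
    evalPoly (sumP (map (term N) ts)) (fromℤ k)
      ≡⟨ evalPoly-sumP (map (term N) ts) (fromℤ k) ⟩
    sumℚ (map (λ p → evalPoly p (fromℤ k)) (map (term N) ts))
      ≡⟨ cong sumℚ (List.map-∘ ts) ⟨
    sumℚ (map (λ t → evalPoly (term N t) (fromℤ k)) ts)
      ≡⟨ cong sumℚ (List.map-cong-local (All.map term≈ (incTuples-increasing a 1 N))) ⟩
    sumℚ (map (fromℤ ∘ coeffOf) ts)
      ≡⟨ cong sumℚ (List.map-∘ ts) ⟩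
    sumℚ (map fromℤ (map coeffOf ts))
      ≡⟨ fromℤ-sumℤ (map coeffOf ts) ⟨
    fromℤ (tupleCoeff a σ k N)
      ∎
    where
    open ≡-Reasoning
    ts : List (List ℕ)
    ts = incTuples a 1 N
    coeffOf : List ℕ → ℤ
    coeffOf t = shiftCoeff (σ t) (prodInv k t) N
    term≈ : ∀ {t} → IncreasingFrom 1 t × length t ≡ a → evalPoly (term N t) (fromℤ k) ≡ fromℤ (coeffOf t)
    term≈ {t} (incr , _) =
      shift-represents (productSeries t) (productSeries-represents (IncreasingFrom⇒All≥ incr)) (σ t) k N

  module _ {Th : ℕ} (Th≤σ : ∀ {t} → IncreasingFrom 1 t → length t ≡ a → Th ≤ σ t) where

    tupleSeries-vanishes : ∀ N i → N < Th + i → coeff (tupleSeries a σ N) i ≡ 0ℚ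
    tupleSeries-vanishes N i N<Th+i =
      trans (coeff-tupleSeries N i) (sumℚ-zero (All.map⁺ (All.map term≡0 (incTuples-increasing a 1 N))))
      where
      term≡0 : ∀ {t} → IncreasingFrom 1 t × length t ≡ a → coeff (term N t) i ≡ 0ℚ
      term≡0 {t} (incr , len) =
        shift-coeff-vanishes (productSeries-triangular t) i (ℕ.<-≤-trans N<Th+i (ℕ.+-monoˡ-≤ i (Th≤σ incr len)))

    tupleSeries-leading : 1 ≤ a → σ (range 1 a) ≡ Th → a ≤ Th →
                          ∀ N → Th ≤ N → 0ℚ <ℚ coeff (tupleSeries a σ N) (N ∸ Th)
    tupleSeries-leading 1≤a σ≡Th a≤Th N Th≤N =
      subst (0ℚ <ℚ_) (sym (coeff-tupleSeries N (N ∸ Th)))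
        (sumℚ-pos (All.map⁺ (All.map term≥0 (incTuples-increasing a 1 N)))
                  (Any.map⁺ (Any.map (λ { refl → range-term>0 }) (range∈incTuples a 1 N a+1≤1+N))))
      where
      a+1≤1+N : a + 1 ≤ suc N
      a+1≤1+N = subst (_≤ suc N) (ℕ.+-comm 1 a) (s≤s (ℕ.≤-trans a≤Th Th≤N))
      term≥0 : ∀ {t} → IncreasingFrom 1 t × length t ≡ a → 0ℚ ≤ℚ coeff (term N t) (N ∸ Th)
      term≥0 {t} (incr , len) =
        shift-coeff-nonneg (productSeries-triangular t) (N ∸ Th)
          (ℕ.≤-trans (ℕ.m≤n+m∸n N Th) (ℕ.+-monoˡ-≤ (N ∸ Th) (Th≤σ incr len)))
      range-term>0 : 0ℚ <ℚ coeff (term N (range 1 a)) (N ∸ Th)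
      range-term>0 =
        subst (λ e → 0ℚ <ℚ coeff (shift [] e (productSeries (range 1 a)) N) (N ∸ Th)) (sym σ≡Th)
          (subst (0ℚ <ℚ_) (sym (shift-coeff-diagonal (productSeries (range 1 a)) Th≤N))
            (productSeries-range-diagonal-pos 1≤a (N ∸ Th)))

tupleCoeff-polynomial : ∀ a σ → 1 ≤ a → (∀ {t} → IncreasingFrom 1 t → σ (range 1 (length t)) ≤ σ t) →
                        a ≤ σ (range 1 a) → HasPolynomialCoefficients (σ (range 1 a)) (tupleCoeff a σ)
tupleCoeff-polynomial a σ 1≤a σ-minimal a≤Th =
  polynomialCoefficients (tupleSeries a σ) (tupleSeries-represents a σ)
    (tupleSeries-vanishes a σ Th≤σ) (tupleSeries-leading a σ Th≤σ 1≤a refl a≤Th)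
  where
  Th≤σ : ∀ {t} → IncreasingFrom 1 t → length t ≡ a → σ (range 1 a) ≤ σ t
  Th≤σ {t} incr len = subst (λ m → σ (range 1 m) ≤ σ t) len (σ-minimal incr)

-- The weights of A and B

range-snoc : ∀ lo a → range lo (suc a) ≡ range lo a ++ lo + a ∷ []
range-snoc lo zero    = cong (_∷ []) (sym (ℕ.+-identityʳ lo))
range-snoc lo (suc a) =
  cong (lo ∷_) (trans (range-snoc (suc lo) a) (cong (λ x → range (suc lo) a ++ x ∷ []) (sym (ℕ.+-suc lo a))))

sum-snoc : ∀ xs x → sumℕ (xs ++ x ∷ []) ≡ sumℕ xs + x
sum-snoc xs x = trans (sum-++ xs (x ∷ [])) (cong (ℕ._+_ (sumℕ xs)) (ℕ.+-identityʳ x))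

sum-range : ∀ a → 2 * sumℕ (range 1 a) ≡ a * (a + 1)
sum-range zero    = refl
sum-range (suc a) = begin
  2 * sumℕ (range 1 (suc a))          ≡⟨ cong (λ xs → 2 * sumℕ xs) (range-snoc 1 a) ⟩
  2 * sumℕ (range 1 a ++ suc a ∷ [])  ≡⟨ cong (2 *_) (sum-snoc (range 1 a) (suc a)) ⟩
  2 * (sumℕ (range 1 a) + suc a)      ≡⟨ ℕ.*-distribˡ-+ 2 (sumℕ (range 1 a)) (suc a) ⟩
  2 * sumℕ (range 1 a) + 2 * suc a    ≡⟨ cong (_+ 2 * suc a) (sum-range a) ⟩
  a * (a + 1) + 2 * suc a             ≡⟨ step a ⟩
  suc a * (suc a + 1)                 ∎
  where
  open ≡-Reasoning
  step : ∀ a → a * (a + 1) + 2 * suc a ≡ suc a * (suc a + 1)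
  step = ℕ-RingSolver.solve-∀

square : ℕ → ℕ
square n = n * n

sum-squares-range : ∀ a → 6 * sumℕ (map square (range 1 a)) ≡ a * (a + 1) * (2 * a + 1)
sum-squares-range zero    = refl
sum-squares-range (suc a) = begin
  6 * sumℕ (map square (range 1 (suc a)))
    ≡⟨ cong (λ xs → 6 * sumℕ (map square xs)) (range-snoc 1 a) ⟩
  6 * sumℕ (map square (range 1 a ++ suc a ∷ []))
    ≡⟨ cong (λ xs → 6 * sumℕ xs) (List.map-++ square (range 1 a) (suc a ∷ [])) ⟩
  6 * sumℕ (map square (range 1 a) ++ square (suc a) ∷ [])
    ≡⟨ cong (6 *_) (sum-snoc (map square (range 1 a)) (square (suc a))) ⟩
  6 * (Q + square (suc a))
    ≡⟨ ℕ.*-distribˡ-+ 6 Q (square (suc a)) ⟩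
  6 * Q + 6 * square (suc a)
    ≡⟨ cong (_+ 6 * square (suc a)) (sum-squares-range a) ⟩
  a * (a + 1) * (2 * a + 1) + 6 * (suc a * suc a)
    ≡⟨ step a ⟩
  suc a * (suc a + 1) * (2 * suc a + 1)
    ∎
  where
  open ≡-Reasoning
  Q : ℕ
  Q = sumℕ (map square (range 1 a))
  step : ∀ a → a * (a + 1) * (2 * a + 1) + 6 * (suc a * suc a) ≡ suc a * (suc a + 1) * (2 * suc a + 1)
  step = ℕ-RingSolver.solve-∀

a≤sum-range : ∀ lo a → 1 ≤ lo → a ≤ sumℕ (range lo a)
a≤sum-range lo zero    _    = z≤n
a≤sum-range lo (suc a) 1≤lo = ℕ.+-mono-≤ 1≤lo (a≤sum-range (suc lo) a (s≤s z≤n))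

≡*⇒/≡ : ∀ {m q} n .{{_ : ℕ.NonZero n}} → m ≡ q * n → q ≡ m / n
≡*⇒/≡ {q = q} n m≡q*n = sym (trans (cong (_/ n) m≡q*n) (m*n/n≡m q n))

weightA-range : ∀ r a → r * sumℕ (range 1 a) ≡ (r * a * (a + 1)) / 2
weightA-range r a = ≡*⇒/≡ 2 (begin
  r * a * (a + 1)    ≡⟨ ℕ.*-assoc r a (a + 1) ⟩
  r * (a * (a + 1))  ≡⟨ cong (r *_) (sum-range a) ⟨
  r * (2 * S)        ≡⟨ regroup r S ⟩
  r * S * 2          ∎)
  where
  open ≡-Reasoning
  S : ℕ
  S = sumℕ (range 1 a)
  regroup : ∀ r S → r * (2 * S) ≡ r * S * 2
  regroup = ℕ-RingSolver.solve-∀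

weightB-range : ∀ r s a →
  r * sumℕ (map square (range 1 a)) + s * sumℕ (range 1 a) ≡ (a * (a + 1) * (r + 2 * a * r + 3 * s)) / 6
weightB-range r s a = ≡*⇒/≡ 6 (begin
  a * (a + 1) * (r + 2 * a * r + 3 * s)
    ≡⟨ expand a r s ⟩
  r * (a * (a + 1) * (2 * a + 1)) + 3 * s * (a * (a + 1))
    ≡⟨ cong₂ (λ x y → r * x + 3 * s * y) (sum-squares-range a) (sum-range a) ⟨
  r * (6 * Q) + 3 * s * (2 * S)
    ≡⟨ regroup r s Q S ⟩
  (r * Q + s * S) * 6
    ∎)
  where
  open ≡-Reasoning
  S : ℕ
  S = sumℕ (range 1 a)
  Q : ℕ
  Q = sumℕ (map square (range 1 a))
  expand : ∀ a r s → a * (a + 1) * (r + 2 * a * r + 3 * s) ≡ r * (a * (a + 1) * (2 * a + 1)) + 3 * s * (a * (a + 1))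
  expand = ℕ-RingSolver.solve-∀
  regroup : ∀ r s Q S → r * (6 * Q) + 3 * s * (2 * S) ≡ (r * Q + s * S) * 6
  regroup = ℕ-RingSolver.solve-∀

coeffA-polynomial : ∀ a r → 1 ≤ a → 1 ≤ r → HasPolynomialCoefficients ((r * a * (a + 1)) / 2) (λ k → coeffA a k r)
coeffA-polynomial a r 1≤a 1≤r =
  subst (λ Th → HasPolynomialCoefficients Th (tupleCoeff a σ)) (weightA-range r a)
    (tupleCoeff-polynomial a σ 1≤a (ℕ.*-monoʳ-≤ r ∘ sum-range-minimal)
      (ℕ.≤-trans (a≤sum-range 1 a ℕ.≤-refl) (ℕ.m≤n*m (sumℕ (range 1 a)) r {{ℕ.>-nonZero 1≤r}})))
  where
  σ : List ℕ → ℕ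
  σ t = r * sumℕ t

coeffB-polynomial : ∀ a r s → 1 ≤ a → 1 ≤ s →
  HasPolynomialCoefficients ((a * (a + 1) * (r + 2 * a * r + 3 * s)) / 6) (λ k → coeffB a k r s)
coeffB-polynomial a r s 1≤a 1≤s =
  subst (λ Th → HasPolynomialCoefficients Th (tupleCoeff a σ)) (weightB-range r s a)
    (tupleCoeff-polynomial a σ 1≤a σ-minimal
      (ℕ.≤-trans (a≤sum-range 1 a ℕ.≤-refl)
        (ℕ.≤-trans (ℕ.m≤n*m S s {{ℕ.>-nonZero 1≤s}}) (ℕ.m≤n+m (s * S) (r * sumℕ (map square (range 1 a)))))))
  where
  S : ℕ
  S = sumℕ (range 1 a)
  σ : List ℕ → ℕ
  σ t = r * sumℕ (map square t) + s * sumℕ t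
  σ-minimal : ∀ {t} → IncreasingFrom 1 t → σ (range 1 (length t)) ≤ σ t
  σ-minimal incr = ℕ.+-mono-≤ (ℕ.*-monoʳ-≤ r (sum-map-range-minimal square (λ le → ℕ.*-mono-≤ le le) incr))
                              (ℕ.*-monoʳ-≤ s (sum-range-minimal incr))

corollary1p4 : (a r : ℕ) → 1 ≤ a → 1 ≤ r →
    (Σ (ℕ → Poly) λ P →
        ((k : ℤ) (n : ℕ) → evalPoly (P n) (ℤtoℚ k) ≡ ℤtoℚ (coeffA a k r n))
      × ((n : ℕ) → (r * a * (a + 1)) / 2 ≤ n → HasDegree (P n) (n ∸ (r * a * (a + 1)) / 2))
      × ((n : ℕ) → n < (r * a * (a + 1)) / 2 → IsZeroPoly (P n)))
    × ((s : ℕ) → 1 ≤ s →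
      Σ (ℕ → Poly) λ P →
          ((k : ℤ) (n : ℕ) → evalPoly (P n) (ℤtoℚ k) ≡ ℤtoℚ (coeffB a k r s n))
        × ((n : ℕ) → (a * (a + 1) * (r + 2 * a * r + 3 * s)) / 6 ≤ n →
             HasDegree (P n) (n ∸ (a * (a + 1) * (r + 2 * a * r + 3 * s)) / 6))
        × ((n : ℕ) → n < (a * (a + 1) * (r + 2 * a * r + 3 * s)) / 6 → IsZeroPoly (P n)))
corollary1p4 a r 1≤a 1≤r = coeffA-polynomial a r 1≤a 1≤r , λ s → coeffB-polynomial a r s 1≤a
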